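{- For every (possibly infinite) set $\mathfrak R$ of hypergraphs and every excisive clustering scheme $\mathfrak c$, the composite clustering scheme $G\mapsto\mathfrak c(\Phi_{\mathfrak R}(G))$ is excisive.
   Context: A hypergraph is a triple $G=(V,E,\epsilon)$, where $V$ is a finite vertex set, $E$ is a finite edge set disjoint from $V$, and $\epsilon:E\to2^V$ gives edge vertex sets. Distinct edges may have the same vertex set. A morphism $H\to G$ is an injective map $f:V(H)\to V(G)$ such that for every edge $e$ of $H$ there is an edge $e'$ of $G$ with $f(\epsilon_H(e))=\epsilon_G(e')$; $\hom(H,G)$ is the set of morphisms. For $p\subseteq V$, the restriction $G|_p$ has vertex set $p$ and those edges $e$ with $\epsilon(e)\subseteq p$. A clustering scheme $\mathfrak c$ assigns to each hypergraph $G$ a pair $(V(G),P)$ with $P\subseteq 2^{V(G)}$, a set of parts that need not be disjoint or covering. It is excisive if for every $G$ and every part $p$ of $\mathfrak c(G)$, $p$ is a part of $\mathfrak c(G|_p)$. For a set $\mathfrak R$ of hypergraphs, $\Phi_{\mathfrak R}(G)$ has vertex set $V(G)$ and edge set $\bigcup_{R\in\mathfrak R}\hom(R,G)$ (disjoint union), where the edge $\omega\in\hom(R,G)$ has vertex set $\omega(V(R))$. -}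

module Defs where

open import Level using (Level; _⊔_; suc; Lift; lift; lower; Setω)
open import Data.Product using (Σ; Σ-syntax; _×_; _,_; proj₁; proj₂)
open import Relation.Unary using (Pred; _⊆_; _≐_)
open import Relation.Binary.PropositionalEquality using (_≡_)

-- Sets are modelled as predicates on a carrier type.  A hypergraph over a
-- vertex carrier VC and an edge carrier EC has vertex set V ⊆ VC, edge set
-- E ⊆ EC and incidence ε : E → 2^V.
record HG {b : Level} (VC : Set) (EC : Set b) (ℓ : Level) : Set (b ⊔ suc ℓ) where
  field
    V   : Pred VC ℓ
    E   : Pred EC ℓ
    ε   : EC → Pred VC ℓ
    ε⊆V : ∀ {e} → E e → ε e ⊆ V
open HG public

record Hypergraph (b ℓ : Level) : Set (suc (b ⊔ ℓ)) where
  field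
    VC  : Set
    EC  : Set b
    str : HG VC EC ℓ
open Hypergraph public

record _≅_ {b ℓ} {VC : Set} {EC : Set b} (G H : HG VC EC ℓ) : Set (b ⊔ ℓ) where
  field
    V≐ : V G ≐ V H
    E≐ : E G ≐ E H
    ε≐ : ∀ {e} → E G e → ε G e ≐ ε H e

_∣_ : ∀ {b ℓ} {VC : Set} {EC : Set b} → HG VC EC ℓ → Pred VC ℓ → HG VC EC ℓ
G ∣ p = record
  { V   = p
  ; E   = λ e → E G e × (ε G e ⊆ p)
  ; ε   = ε G
  ; ε⊆V = λ e∈ → proj₂ e∈
  }

image : ∀ {ℓ} {VC VC' : Set} {V : Pred VC ℓ} →
        (Σ VC V → VC') → Pred VC ℓ → Pred VC' ℓ
image {V = V} f S y = Σ[ x ∈ Σ _ V ] (S (proj₁ x) × f x ≡ y)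

record IsMorphism {b₀ ℓ₀ b ℓ} {VC : Set} {EC : Set b}
                  (H : Hypergraph b₀ ℓ₀) (G : HG VC EC ℓ)
                  (f : Σ (Hypergraph.VC H) (V (str H)) → VC)
                  : Set (b₀ ⊔ ℓ₀ ⊔ b ⊔ ℓ) where
  field
    into  : ∀ x → V G (f x)
    inj   : ∀ x y → f x ≡ f y → x ≡ y
    edges : ∀ e → E (str H) e →
            Σ[ e' ∈ EC ] (E G e' × (image f (ε (str H) e) ≐ ε G e'))

-- Edge names of Φ_ℜ(G): pairs (R , ω) with ω a map V(R) → VC.
ΦEdge : (b₀ ℓ₀ : Level) → Set → Set (suc (b₀ ⊔ ℓ₀))
ΦEdge b₀ ℓ₀ VC = Σ[ R ∈ Hypergraph b₀ ℓ₀ ] (Σ (Hypergraph.VC R) (V (str R)) → VC)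

Φ : ∀ {b₀ ℓ₀ r b ℓ} (ℜ : Pred (Hypergraph b₀ ℓ₀) r)
    {VC : Set} {EC : Set b} → HG VC EC ℓ →
    HG VC (ΦEdge b₀ ℓ₀ VC) (b₀ ⊔ ℓ₀ ⊔ r ⊔ b ⊔ ℓ)
Φ {b₀} {ℓ₀} {r} {b} {ℓ} ℜ G = record
  { V   = λ x → Lift L (V G x)
  ; E   = λ { (R , ω) → ℜ R × IsMorphism R G ω }
  ; ε   = λ { (R , ω) y → Lift L (image ω (V (str R)) y) }
  ; ε⊆V = λ { {R , ω} (_ , m) (lift (x , _ , eq)) →
                lift (subst′ (V G) eq (IsMorphism.into m x)) }
  }
  where
    L = b₀ ⊔ ℓ₀ ⊔ r ⊔ b ⊔ ℓ
    subst′ : ∀ {a p} {A : Set a} (P : A → Set p) {x y} → x ≡ y → P x → P y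
    subst′ P _≡_.refl px = px

-- Since sets are modelled by predicates, membership of a part must respect
-- extensional equality (automatic for sets in the paper).
record ClusteringScheme : Setω where
  field
    Part     : ∀ {b ℓ} {VC : Set} {EC : Set b} →
               HG VC EC ℓ → Pred VC ℓ → Set (b ⊔ suc ℓ)
    Part⊆V   : ∀ {b ℓ} {VC : Set} {EC : Set b} {G : HG VC EC ℓ} {p} →
               Part G p → p ⊆ V G
    Part-ext : ∀ {b ℓ} {VC : Set} {EC : Set b} {G H : HG VC EC ℓ} {p q} →
               G ≅ H → p ≐ q → Part G p → Part H q
open ClusteringScheme public

Excisive : ClusteringScheme → Setω
Excisive c = ∀ {b ℓ} {VC : Set} {EC : Set b} (G : HG VC EC ℓ) (p : Pred VC ℓ) →
             Part c G p → Part c (G ∣ p) p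

-- The parts of the composite scheme G ↦ c(Φ_ℜ(G)) (a part is a subset of
-- V(G) = V(Φ_ℜ(G)); Lift only adjusts the universe level of the predicate).
ΦPart : ∀ {b₀ ℓ₀ r} (ℜ : Pred (Hypergraph b₀ ℓ₀) r) (c : ClusteringScheme)
        {b ℓ} {VC : Set} {EC : Set b} → HG VC EC ℓ → Pred VC ℓ →
        Set (suc (b₀ ⊔ ℓ₀ ⊔ r ⊔ b ⊔ ℓ))
ΦPart {b₀} {ℓ₀} {r} ℜ c {b} {ℓ} G p =
  Part c (Φ ℜ G) (λ x → Lift (b₀ ⊔ ℓ₀ ⊔ r ⊔ b) (p x))

ΦExcisive : ∀ {b₀ ℓ₀ r} (ℜ : Pred (Hypergraph b₀ ℓ₀) r) (c : ClusteringScheme) → Setω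
ΦExcisive ℜ c = ∀ {b ℓ} {VC : Set} {EC : Set b} (G : HG VC EC ℓ) (p : Pred VC ℓ) →
                ΦPart ℜ c G p → ΦPart ℜ c (G ∣ p) p

{-# OPTIONS --safe #-}
module Submission where

-- An edge ω of Φ_ℜ(G) survives restriction to p exactly when the image of ω lies in p,
-- i.e. when ω is a morphism into G|_p. Hence Φ_ℜ(G)|_p = Φ_ℜ(G|_p) for every p ⊆ V(G),
-- so excisiveness of c applied to Φ_ℜ(G) is excisiveness of the composite scheme at G.

open import Defs
open import Function using (id)
open import Level using (_⊔_; Lift; lift; lower)
open import Data.Product using (Σ; _,_; proj₂)
open import Relation.Unary using (Pred; _⊆_)
open import Relation.Binary.PropositionalEquality using (refl)

module _ {b₀ ℓ₀ b ℓ} {R : Hypergraph b₀ ℓ₀} {VC : Set} {EC : Set b} {G : HG VC EC ℓ}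
         {ω : Σ (Hypergraph.VC R) (V (str R)) → VC} where

  IsMorphism-image⊆V : IsMorphism R G ω → image ω (V (str R)) ⊆ V G
  IsMorphism-image⊆V m (x , _ , refl) = IsMorphism.into m x

  IsMorphism-restrict : {p : Pred VC ℓ} → image ω (V (str R)) ⊆ p →
                        IsMorphism R G ω → IsMorphism R (G ∣ p) ω
  IsMorphism-restrict {p} ω⊆p m = record
    { into  = λ x → ω⊆p (x , proj₂ x , refl)
    ; inj   = IsMorphism.inj m
    ; edges = λ e e∈E → let (e' , e'∈E , ωe≐e') = IsMorphism.edges m e e∈E in
        e' , (e'∈E , λ y∈e' → image⊆p (proj₂ ωe≐e' y∈e')) , ωe≐e'
    }
    where
      image⊆p : ∀ {S} → image ω S ⊆ p
      image⊆p (x , _ , refl) = ω⊆p (x , proj₂ x , refl)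

  IsMorphism-unrestrict : {p : Pred VC ℓ} → p ⊆ V G →
                          IsMorphism R (G ∣ p) ω → IsMorphism R G ω
  IsMorphism-unrestrict p⊆V m = record
    { into  = λ x → p⊆V (IsMorphism.into m x)
    ; inj   = IsMorphism.inj m
    ; edges = λ e e∈E → let (e' , (e'∈E , _) , ωe≐e') = IsMorphism.edges m e e∈E in
        e' , e'∈E , ωe≐e'
    }

Φ-restrict-≅ : ∀ {b₀ ℓ₀ r} (ℜ : Pred (Hypergraph b₀ ℓ₀) r)
               {b ℓ} {VC : Set} {EC : Set b} {G : HG VC EC ℓ} {p : Pred VC ℓ} →
               p ⊆ V G →
               (Φ ℜ G ∣ (λ x → Lift (b₀ ⊔ ℓ₀ ⊔ r ⊔ b) (p x))) ≅ Φ ℜ (G ∣ p)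
Φ-restrict-≅ ℜ p⊆V = record
  { V≐ = (λ x∈p → lift (lower x∈p)) , (λ x∈p → lift (lower x∈p))
  ; E≐ = (λ { ((R∈ℜ , m) , ω⊆p) →
                R∈ℜ , IsMorphism-restrict (λ y∈ω → lower (ω⊆p (lift y∈ω))) m })
       , (λ { (R∈ℜ , m) →
                (R∈ℜ , IsMorphism-unrestrict p⊆V m)
              , (λ y∈ω → lift (IsMorphism-image⊆V m (lower y∈ω))) })
  ; ε≐ = λ _ → id , id
  }

mainTheorem8 : ∀ {b₀ ℓ₀ r} (ℜ : Pred (Hypergraph b₀ ℓ₀) r) (c : ClusteringScheme) →
    Excisive c → ΦExcisive ℜ c
mainTheorem8 ℜ c excisive G p part =
  Part-ext c (Φ-restrict-≅ ℜ p⊆V) (id , id) (excisive (Φ ℜ G) _ part)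
  where
    p⊆V : p ⊆ V G
    p⊆V x∈p = lower (Part⊆V c part (lift x∈p))
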